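{- Let $n\geq 1$ and let $(A,B)$ be a disjoint pair of $n$-ary RE relations. If $(A,B)$ is semi-doubly universal, then $(A,B)$ is doubly universal.
   Context: An $n$-ary functional on $\mathbb N^m$ is a map $F:\mathbb N^m\to\mathbb N^n$, written $F(\vec x)=(f_1(\vec x),\dots,f_n(\vec x))$; it is recursive if each $f_i$ is recursive. For disjoint pairs $(A,B)$, $(C,D)$ of $n$-ary RE relations, a recursive $n$-ary functional $F$ on $\mathbb N^n$ is a semi-reduction from $(C,D)$ to $(A,B)$ if for all $\vec a\in\mathbb N^n$: $\vec a\in C\Rightarrow F(\vec a)\in A$ and $\vec a\in D\Rightarrow F(\vec a)\in B$; it is a reduction if moreover both implications are equivalences. $(A,B)$ is semi-doubly universal (semi-DU) if every disjoint pair of $n$-ary RE relations has a semi-reduction to $(A,B)$, and doubly universal (DU) if every disjoint pair of $n$-ary RE relations has a reduction to $(A,B)$. -}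

module Defs where

open import Data.Nat using (ℕ; zero; suc; _<_)
open import Data.Fin using (Fin)
open import Data.Vec using (Vec; []; _∷_; lookup)
open import Data.Product using (Σ; ∃; _×_; _,_)
open import Data.Empty using (⊥)
open import Function.Bundles using (_⇔_)

data Code : ℕ → Set where
  zer  : ∀ {n} → Code n
  succ : Code 1
  proj : ∀ {n} → Fin n → Code n
  comp : ∀ {m n} → Code m → Vec (Code n) m → Code n
  prec : ∀ {n} → Code n → Code (suc (suc n)) → Code (suc n)
    -- primitive recursion on the first argument:
    -- h(0,x) = g(x),  h(k+1,x) = s(k, h(k,x), x)
  mu   : ∀ {n} → Code (suc n) → Code n
    -- unbounded minimisation on the first argument:
    -- μ f (x) = least y with f(y,x) = 0 (all f(z,x), z < y, defined and nonzero)

mutual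
  data _⟦_⟧↓_ : ∀ {n} → Code n → Vec ℕ n → ℕ → Set where
    ev-zer  : ∀ {n} {x : Vec ℕ n} → zer ⟦ x ⟧↓ 0
    ev-succ : ∀ {k} → succ ⟦ k ∷ [] ⟧↓ suc k
    ev-proj : ∀ {n} {i : Fin n} {x : Vec ℕ n} → proj i ⟦ x ⟧↓ lookup x i
    ev-comp : ∀ {m n} {f : Code m} {gs : Vec (Code n) m} {x : Vec ℕ n}
                {ys : Vec ℕ m} {y : ℕ} →
              gs ⟦ x ⟧↓* ys → f ⟦ ys ⟧↓ y → comp f gs ⟦ x ⟧↓ y
    ev-prec-zero : ∀ {n} {g : Code n} {s : Code (suc (suc n))} {x : Vec ℕ n} {y : ℕ} →
              g ⟦ x ⟧↓ y → prec g s ⟦ zero ∷ x ⟧↓ y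
    ev-prec-suc : ∀ {n} {g : Code n} {s : Code (suc (suc n))} {x : Vec ℕ n} {k r y : ℕ} →
              prec g s ⟦ k ∷ x ⟧↓ r → s ⟦ k ∷ r ∷ x ⟧↓ y → prec g s ⟦ suc k ∷ x ⟧↓ y
    ev-mu   : ∀ {n} {f : Code (suc n)} {x : Vec ℕ n} {y : ℕ} →
              f ⟦ y ∷ x ⟧↓ 0 →
              (∀ z → z < y → Σ ℕ λ v → f ⟦ z ∷ x ⟧↓ suc v) →
              mu f ⟦ x ⟧↓ y

  data _⟦_⟧↓*_ : ∀ {m n} → Vec (Code n) m → Vec ℕ n → Vec ℕ m → Set where
    ev-[] : ∀ {n} {x : Vec ℕ n} → [] ⟦ x ⟧↓* []
    ev-∷  : ∀ {m n} {g : Code n} {gs : Vec (Code n) m} {x : Vec ℕ n} {y : ℕ} {ys : Vec ℕ m} →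
            g ⟦ x ⟧↓ y → gs ⟦ x ⟧↓* ys → (g ∷ gs) ⟦ x ⟧↓* (y ∷ ys)

Rel : ℕ → Set₁
Rel n = Vec ℕ n → Set

Recursive : ∀ {m} → (Vec ℕ m → ℕ) → Set
Recursive {m} f = Σ (Code m) λ e → ∀ x → e ⟦ x ⟧↓ f x

RecursiveFunctional : ∀ {m n} → (Vec ℕ m → Vec ℕ n) → Set
RecursiveFunctional {m} {n} F = ∀ (i : Fin n) → Recursive (λ x → lookup (F x) i)

RE : ∀ {n} → Rel n → Set
RE {n} A = Σ (Code n) λ e → ∀ x → A x ⇔ (∃ λ y → e ⟦ x ⟧↓ y)

Disjoint : ∀ {n} → Rel n → Rel n → Set
Disjoint {n} A B = ∀ (x : Vec ℕ n) → A x → B x → ⊥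

IsSemiReduction : ∀ {n} → (Vec ℕ n → Vec ℕ n) → Rel n → Rel n → Rel n → Rel n → Set
IsSemiReduction F C D A B =
  RecursiveFunctional F × (∀ a → (C a → A (F a)) × (D a → B (F a)))

IsReduction : ∀ {n} → (Vec ℕ n → Vec ℕ n) → Rel n → Rel n → Rel n → Rel n → Set
IsReduction F C D A B =
  RecursiveFunctional F × (∀ a → (C a ⇔ A (F a)) × (D a ⇔ B (F a)))

SemiDU : ∀ {n} → Rel n → Rel n → Set₁
SemiDU {n} A B = ∀ (C D : Rel n) → RE C → RE D → Disjoint C D →
  Σ (Vec ℕ n → Vec ℕ n) λ F → IsSemiReduction F C D A B

DU : ∀ {n} → Rel n → Rel n → Set₁
DU {n} A B = ∀ (C D : Rel n) → RE C → RE D → Disjoint C D →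
  Σ (Vec ℕ n → Vec ℕ n) λ F → IsReduction F C D A B

-- Write ⟨j , a⟩ for the input (pair j a₀ , a₁ , …) and fix RE codes of A, B, C, D.  Two searches
-- race on ⟨j , a⟩, stage by stage, through finite lists of evaluation claims checked by a
-- recursive validity test: the first looks for a halting computation of C on a, or of B on the
-- outputs of the programs listed in j run on (j , a); the second likewise for D and A.  "The first
-- search succeeds at a stage where the second has not" and its mirror image are disjoint RE
-- relations C′ and D′, so (A , B) admits a semi-reduction G from (C′ , D′).  Let j list programs
-- computing v ↦ G ⟨v₀ , v₁ , …⟩; then the outputs searched for are F a = G ⟨j , a⟩.  If C a holds,
-- the first search succeeds; if the second succeeds no later, then D a (impossible) or A (F a)
-- holds, and otherwise C′ ⟨j , a⟩ holds and G sends it into A.  This and the three symmetric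
-- arguments show that F is a reduction.  Packing j into the first coordinate needs n ≥ 1.

module Submission where

open import Defs
open import Data.Nat
open import Data.Nat.Properties
open import Data.Nat.GeneralisedArithmetic using (fold; iterate; iterate-is-fold)
open import Data.Fin using (Fin; zero; suc; toℕ; fromℕ<)
open import Data.Fin.Properties using (toℕ-fromℕ<; toℕ<n)
open import Data.Vec using (Vec; []; _∷_; lookup; tabulate; head; tail)
open import Data.Vec.Properties using (lookup∘tabulate; tabulate∘lookup; tabulate-cong)
open import Data.List using (List; []; _∷_; _++_)
open import Data.List.Membership.Propositional using (_∈_)
open import Data.List.Membership.Propositional.Properties using (∈-++⁺ˡ; ∈-++⁺ʳ; ∈-++⁻)
open import Data.List.Relation.Unary.Any using (here; there)
open import Data.List.Relation.Binary.Subset.Propositional using (_⊆_)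
open import Data.Product
open import Data.Sum using (_⊎_; inj₁; inj₂; [_,_]′)
import Data.Sum as Sum
open import Data.Empty using (⊥; ⊥-elim)
open import Data.Bool using (Bool; true; false; T; not; _∧_; _∨_; if_then_else_)
open import Data.Bool.Properties using (if-float; T-∧; T-∨; T-≡; T-not-≡)
open import Function.Bundles using (_⇔_; mk⇔; Equivalence)
open import Relation.Nullary using (¬_; yes; no; Dec)
open import Relation.Binary.Definitions using (tri<; tri≈; tri>)
open import Relation.Binary.PropositionalEquality

open Equivalence using (to; from)

-- Recursive functions

rec-cong : ∀ {n} {f g : Vec ℕ n → ℕ} → Recursive f → (∀ x → f x ≡ g x) → Recursive g
rec-cong (e , ev) f≗g = e , λ x → subst (e ⟦ x ⟧↓_) (f≗g x) (ev x)

rec-var : ∀ {n} (i : Fin n) → Recursive (λ x → lookup x i)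
rec-var i = proj i , λ _ → ev-proj

rec-0 : ∀ {n} → Recursive {n} (λ _ → 0)
rec-0 = zer , λ _ → ev-zer

rec-∘ : ∀ {m n} {f : Vec ℕ m → ℕ} {G : Vec ℕ n → Vec ℕ m} →
        Recursive f → RecursiveFunctional G → Recursive (λ x → f (G x))
rec-∘ {G = G} (e , ev) rG = comp e (codes _ rG) , λ x →
  ev-comp (subst (_ ⟦ x ⟧↓*_) (tabulate∘lookup (G x)) (codes-eval _ rG x)) (ev (G x))
  where
  codes : ∀ {m n} (gs : Fin m → Vec ℕ n → ℕ) → (∀ i → Recursive (gs i)) → Vec (Code n) m
  codes {zero}  gs rgs = []
  codes {suc m} gs rgs = proj₁ (rgs zero) ∷ codes (λ i → gs (suc i)) (λ i → rgs (suc i))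

  codes-eval : ∀ {m n} (gs : Fin m → Vec ℕ n → ℕ) (rgs : ∀ i → Recursive (gs i)) x →
               codes gs rgs ⟦ x ⟧↓* tabulate (λ i → gs i x)
  codes-eval {zero}  gs rgs x = ev-[]
  codes-eval {suc m} gs rgs x =
    ev-∷ (proj₂ (rgs zero) x) (codes-eval (λ i → gs (suc i)) (λ i → rgs (suc i)) x)

rec-∘₁ : ∀ {n} {h : Vec ℕ 1 → ℕ} {f : Vec ℕ n → ℕ} →
         Recursive h → Recursive f → Recursive (λ x → h (f x ∷ []))
rec-∘₁ rh rf = rec-∘ rh λ { zero → rf }

rec-∘₂ : ∀ {n} {h : Vec ℕ 2 → ℕ} {f g : Vec ℕ n → ℕ} →
         Recursive h → Recursive f → Recursive g → Recursive (λ x → h (f x ∷ g x ∷ []))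
rec-∘₂ rh rf rg = rec-∘ rh λ { zero → rf ; (suc zero) → rg }

rec-∘₃ : ∀ {n} {h : Vec ℕ 3 → ℕ} {f g k : Vec ℕ n → ℕ} → Recursive h →
         Recursive f → Recursive g → Recursive k → Recursive (λ x → h (f x ∷ g x ∷ k x ∷ []))
rec-∘₃ rh rf rg rk = rec-∘ rh λ { zero → rf ; (suc zero) → rg ; (suc (suc zero)) → rk }

rec-tail : ∀ {n} {f : Vec ℕ n → ℕ} → Recursive f → Recursive (λ (x : Vec ℕ (suc n)) → f (tail x))
rec-tail rf = rec-∘ rf λ i → rec-cong (rec-var (suc i)) λ { (_ ∷ _) → refl }

rec-let : ∀ {n} {f : Vec ℕ (suc n) → ℕ} {g : Vec ℕ n → ℕ} →
         Recursive f → Recursive g → Recursive (λ x → f (g x ∷ x))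
rec-let rf rg = rec-∘ rf λ { zero → rg ; (suc i) → rec-var i }

rec-skip : ∀ {n} {f : Vec ℕ (suc n) → ℕ} → Recursive f →
           Recursive (λ (x : Vec ℕ (2 + n)) → f (head x ∷ tail (tail x)))
rec-skip rf = rec-∘ rf λ
  { zero    → rec-cong (rec-var zero) λ { (_ ∷ _) → refl }
  ; (suc i) → rec-cong (rec-var (suc (suc i))) λ { (_ ∷ _ ∷ _) → refl } }

rec-suc : ∀ {n} {f : Vec ℕ n → ℕ} → Recursive f → Recursive (λ x → suc (f x))
rec-suc = rec-∘₁ {h = λ v → suc (lookup v zero)} (succ , λ { (_ ∷ []) → ev-succ })

rec-const : ∀ {n} c → Recursive {n} (λ _ → c)
rec-const zero    = rec-0
rec-const (suc c) = rec-suc (rec-const c)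

primRec : ∀ {n} → (Vec ℕ n → ℕ) → (Vec ℕ (2 + n) → ℕ) → ℕ → Vec ℕ n → ℕ
primRec g s zero    x = g x
primRec g s (suc k) x = s (k ∷ primRec g s k x ∷ x)

rec-primRec : ∀ {n} {g : Vec ℕ n → ℕ} {s : Vec ℕ (2 + n) → ℕ} → Recursive g → Recursive s →
              Recursive (λ x → primRec g s (head x) (tail x))
rec-primRec {g = g} {s} (eg , evg) (es , evs) = prec eg es , λ { (k ∷ x) → eval k x }
  where
  eval : ∀ k x → prec eg es ⟦ k ∷ x ⟧↓ primRec g s k x
  eval zero    x = ev-prec-zero (evg x)
  eval (suc k) x = ev-prec-suc (eval k x) (evs _)

rec-fold : ∀ {n} {f : ℕ → ℕ} {z k : Vec ℕ n → ℕ} → Recursive (λ x → f (lookup x zero)) →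
           Recursive z → Recursive k → Recursive (λ x → fold (z x) f (k x))
rec-fold {f = f} rf rz rk =
  rec-∘₂ {h = λ v → fold (lookup v (suc zero)) f (lookup v zero)}
         (rec-cong (rec-primRec (rec-var zero) (rec-∘₁ rf (rec-var (suc zero))))
                   λ { (k ∷ z ∷ []) → primRec-fold k z })
         rk rz
  where
  primRec-fold : ∀ k z → primRec (λ x → lookup x zero) (λ x → f (lookup x (suc zero))) k (z ∷ []) ≡ fold z f k
  primRec-fold zero    z = refl
  primRec-fold (suc k) z = cong f (primRec-fold k z)

rec-+ : ∀ {n} {f g : Vec ℕ n → ℕ} → Recursive f → Recursive g → Recursive (λ x → f x + g x)
rec-+ = rec-∘₂ {h = λ v → lookup v zero + lookup v (suc zero)}
  (rec-cong (rec-primRec (rec-var zero) (rec-suc (rec-var (suc zero)))) λ { (k ∷ a ∷ []) → primRec-+ k a })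
  where
  primRec-+ : ∀ k a → primRec (λ x → lookup x zero) (λ x → suc (lookup x (suc zero))) k (a ∷ []) ≡ k + a
  primRec-+ zero    a = refl
  primRec-+ (suc k) a = cong suc (primRec-+ k a)

rec-* : ∀ {n} {f g : Vec ℕ n → ℕ} → Recursive f → Recursive g → Recursive (λ x → f x * g x)
rec-* = rec-∘₂ {h = λ v → lookup v zero * lookup v (suc zero)}
  (rec-cong (rec-primRec rec-0 (rec-+ (rec-var (suc zero)) (rec-var (suc (suc zero)))))
            λ { (k ∷ a ∷ []) → primRec-* k a })
  where
  primRec-* : ∀ k a →
    primRec (λ _ → 0) (λ x → lookup x (suc zero) + lookup x (suc (suc zero))) k (a ∷ []) ≡ k * a
  primRec-* zero    a = refl
  primRec-* (suc k) a = trans (cong (_+ a) (primRec-* k a)) (+-comm (k * a) a)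

rec-pred : ∀ {n} {f : Vec ℕ n → ℕ} → Recursive f → Recursive (λ x → pred (f x))
rec-pred = rec-∘₁ {h = λ v → pred (lookup v zero)}
  (rec-cong (rec-primRec rec-0 (rec-var zero)) λ { (zero ∷ []) → refl ; (suc k ∷ []) → refl })

rec-∸ : ∀ {n} {f g : Vec ℕ n → ℕ} → Recursive f → Recursive g → Recursive (λ x → f x ∸ g x)
rec-∸ rf rg = rec-∘₂ {h = λ v → lookup v (suc zero) ∸ lookup v zero}
  (rec-cong (rec-primRec (rec-var zero) (rec-pred (rec-var (suc zero)))) λ { (k ∷ a ∷ []) → primRec-∸ k a })
  rg rf
  where
  primRec-∸ : ∀ k a → primRec (λ x → lookup x zero) (λ x → pred (lookup x (suc zero))) k (a ∷ []) ≡ a ∸ k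
  primRec-∸ zero    a = refl
  primRec-∸ (suc k) a = trans (cong pred (primRec-∸ k a)) (pred[m∸n]≡m∸[1+n] a k)

-- Recursive tests

RecursiveB : ∀ {n} → (Vec ℕ n → Bool) → Set
RecursiveB p = Recursive (λ x → if p x then 1 else 0)

recB-cong : ∀ {n} {p q : Vec ℕ n → Bool} → RecursiveB p → (∀ x → p x ≡ q x) → RecursiveB q
recB-cong rp p≗q = rec-cong rp λ x → cong (if_then 1 else 0) (p≗q x)

rec-if : ∀ {n} {p : Vec ℕ n → Bool} {f g : Vec ℕ n → ℕ} →
         RecursiveB p → Recursive f → Recursive g → Recursive (λ x → if p x then f x else g x)
rec-if {p = p} rp rf rg =
  rec-cong (rec-∘₃ (rec-primRec (rec-var (suc zero)) (rec-var (suc (suc zero)))) rp rf rg)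
           λ x → ifz-indicator (p x)
  where
  ifz-indicator : ∀ b {a c} →
    primRec (λ x → lookup x (suc zero)) (λ x → lookup x (suc (suc zero))) (if b then 1 else 0) (a ∷ c ∷ [])
      ≡ (if b then a else c)
  ifz-indicator true  = refl
  ifz-indicator false = refl

recB-true : ∀ {n} → RecursiveB {n} (λ _ → true)
recB-true = rec-const 1

recB-false : ∀ {n} → RecursiveB {n} (λ _ → false)
recB-false = rec-const 0

recB-if : ∀ {n} {p q r : Vec ℕ n → Bool} →
          RecursiveB p → RecursiveB q → RecursiveB r → RecursiveB (λ x → if p x then q x else r x)
recB-if {p = p} rp rq rr = rec-cong (rec-if rp rq rr) λ x → sym (if-float (if_then 1 else 0) (p x))

recB-not : ∀ {n} {p : Vec ℕ n → Bool} → RecursiveB p → RecursiveB (λ x → not (p x))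
recB-not {p = p} rp = recB-cong (recB-if rp recB-false recB-true) λ x → if-not (p x)
  where
  if-not : ∀ b → (if b then false else true) ≡ not b
  if-not true  = refl
  if-not false = refl

recB-∧ : ∀ {n} {p q : Vec ℕ n → Bool} → RecursiveB p → RecursiveB q → RecursiveB (λ x → p x ∧ q x)
recB-∧ {p = p} rp rq = recB-cong (recB-if rp rq recB-false) λ x → if-∧ (p x)
  where
  if-∧ : ∀ b {c} → (if b then c else false) ≡ b ∧ c
  if-∧ true  = refl
  if-∧ false = refl

recB-∨ : ∀ {n} {p q : Vec ℕ n → Bool} → RecursiveB p → RecursiveB q → RecursiveB (λ x → p x ∨ q x)
recB-∨ {p = p} rp rq = recB-cong (recB-if rp recB-true rq) λ x → if-∨ (p x)
  where
  if-∨ : ∀ b {c} → (if b then true else c) ≡ b ∨ c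
  if-∨ true  = refl
  if-∨ false = refl

-- The indicator of a ≡ b is 1 ∸ ((a ∸ b) + (b ∸ a)).
recB-≡ᵇ : ∀ {n} {f g : Vec ℕ n → ℕ} → Recursive f → Recursive g → RecursiveB (λ x → f x ≡ᵇ g x)
recB-≡ᵇ {f = f} {g} rf rg =
  rec-cong (rec-∸ (rec-const 1) (rec-+ (rec-∸ rf rg) (rec-∸ rg rf))) λ x → distance-test (f x) (g x)
  where
  distance-test : ∀ a b → 1 ∸ ((a ∸ b) + (b ∸ a)) ≡ (if a ≡ᵇ b then 1 else 0)
  distance-test zero    zero    = refl
  distance-test zero    (suc b) = 0∸n≡0 b
  distance-test (suc a) zero    = 0∸n≡0 (a + 0)
  distance-test (suc a) (suc b) = distance-test a b

-- Bounded search

anyBelow : ℕ → (ℕ → Bool) → Bool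
anyBelow zero    f = false
anyBelow (suc k) f = anyBelow k f ∨ f k

allBelow : ℕ → (ℕ → Bool) → Bool
allBelow zero    f = true
allBelow (suc k) f = allBelow k f ∧ f k

anyBelow⁺ : ∀ {b k} (f : ℕ → Bool) → k < b → T (f k) → T (anyBelow b f)
anyBelow⁺ {suc b} f k<1+b fk with m<1+n⇒m<n∨m≡n k<1+b
... | inj₁ k<b  = from T-∨ (inj₁ (anyBelow⁺ f k<b fk))
... | inj₂ refl = from T-∨ (inj₂ fk)

anyBelow⁻ : ∀ b (f : ℕ → Bool) → T (anyBelow b f) → ∃[ k ] k < b × T (f k)
anyBelow⁻ (suc b) f t with to (T-∨ {anyBelow b f}) t
... | inj₁ t′ = let k , k<b , fk = anyBelow⁻ b f t′ in k , m<n⇒m<1+n k<b , fk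
... | inj₂ fb = b , n<1+n b , fb

allBelow⁺ : ∀ b (f : ℕ → Bool) → (∀ k → k < b → T (f k)) → T (allBelow b f)
allBelow⁺ zero    f h = _
allBelow⁺ (suc b) f h = from T-∧ (allBelow⁺ b f (λ k k<b → h k (m<n⇒m<1+n k<b)) , h b (n<1+n b))

allBelow⁻ : ∀ {b} (f : ℕ → Bool) → T (allBelow b f) → ∀ k → k < b → T (f k)
allBelow⁻ {suc b} f t k k<1+b with to (T-∧ {allBelow b f}) t | m<1+n⇒m<n∨m≡n k<1+b
... | t′ , _  | inj₁ k<b  = allBelow⁻ f t′ k k<b
... | _  , fb | inj₂ refl = fb

anyBelow-mono : ∀ {b b′} (f : ℕ → Bool) → b ≤ b′ → T (anyBelow b f) → T (anyBelow b′ f)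
anyBelow-mono {b} f b≤b′ t = let k , k<b , fk = anyBelow⁻ b f t in anyBelow⁺ f (<-≤-trans k<b b≤b′) fk

-- The least k < b with f k; the junk value 0 when there is none.
minBelow : ℕ → (ℕ → Bool) → ℕ
minBelow zero    f = 0
minBelow (suc k) f = if anyBelow k f then minBelow k f else (if f k then k else 0)

minBelow-≡ : ∀ {b a} (f : ℕ → Bool) → a < b → T (f a) → (∀ a′ → a′ < a → ¬ T (f a′)) →
             minBelow b f ≡ a
minBelow-≡ {suc b} {a} f a<1+b fa least with m<1+n⇒m<n∨m≡n a<1+b
... | inj₁ a<b rewrite to T-≡ (anyBelow⁺ f a<b fa) = minBelow-≡ f a<b fa least
... | inj₂ refl with anyBelow a f in found
...   | true  = let a′ , a′<a , fa′ = anyBelow⁻ a f (subst T (sym found) _) in ⊥-elim (least a′ a′<a fa′)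
...   | false rewrite to T-≡ fa = refl

minBelow-≤ : ∀ b (f : ℕ → Bool) → minBelow (suc b) f ≤ b
minBelow-≤ zero    f with f 0
... | true  = z≤n
... | false = z≤n
minBelow-≤ (suc b) f with anyBelow (suc b) f
... | true  = m≤n⇒m≤1+n (minBelow-≤ b f)
... | false with f (suc b)
...   | true  = ≤-refl
...   | false = z≤n

recB-anyBelow : ∀ {n} {b : Vec ℕ n → ℕ} {φ : Vec ℕ (suc n) → Bool} → Recursive b → RecursiveB φ →
                RecursiveB (λ x → anyBelow (b x) (λ k → φ (k ∷ x)))
recB-anyBelow {φ = φ} rb rφ =
  rec-let {f = λ v → if anyBelow (head v) (λ i → φ (i ∷ tail v)) then 1 else 0}
    (rec-cong (rec-primRec rec-0 (rec-if (rec-skip rφ) (rec-const 1) (rec-var (suc zero))))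
              λ { (k ∷ x) → primRec-anyBelow k x })
    rb
  where
  primRec-anyBelow : ∀ k x →
    primRec (λ _ → 0) (λ v → if φ (head v ∷ tail (tail v)) then 1 else lookup v (suc zero)) k x
      ≡ (if anyBelow k (λ i → φ (i ∷ x)) then 1 else 0)
  primRec-anyBelow zero    x = refl
  primRec-anyBelow (suc k) x rewrite primRec-anyBelow k x
    with anyBelow k (λ i → φ (i ∷ x)) | φ (k ∷ x)
  ... | true  | true  = refl
  ... | true  | false = refl
  ... | false | _     = refl

recB-allBelow : ∀ {n} {b : Vec ℕ n → ℕ} {φ : Vec ℕ (suc n) → Bool} → Recursive b → RecursiveB φ →
                RecursiveB (λ x → allBelow (b x) (λ k → φ (k ∷ x)))
recB-allBelow {φ = φ} rb rφ =
  rec-let {f = λ v → if allBelow (head v) (λ i → φ (i ∷ tail v)) then 1 else 0}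
    (rec-cong (rec-primRec (rec-const 1) (rec-if (rec-skip rφ) (rec-var (suc zero)) rec-0))
              λ { (k ∷ x) → primRec-allBelow k x })
    rb
  where
  primRec-allBelow : ∀ k x →
    primRec (λ _ → 1) (λ v → if φ (head v ∷ tail (tail v)) then lookup v (suc zero) else 0) k x
      ≡ (if allBelow k (λ i → φ (i ∷ x)) then 1 else 0)
  primRec-allBelow zero    x = refl
  primRec-allBelow (suc k) x rewrite primRec-allBelow k x
    with allBelow k (λ i → φ (i ∷ x)) | φ (k ∷ x)
  ... | true  | true  = refl
  ... | true  | false = refl
  ... | false | true  = refl
  ... | false | false = refl

rec-minBelow : ∀ {n} {b : Vec ℕ n → ℕ} {φ : Vec ℕ (suc n) → Bool} → Recursive b → RecursiveB φ →
               Recursive (λ x → minBelow (b x) (λ k → φ (k ∷ x)))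
rec-minBelow {φ = φ} rb rφ =
  rec-let {f = λ v → minBelow (head v) (λ i → φ (i ∷ tail v))}
    (rec-cong (rec-primRec rec-0 (rec-if (recB-anyBelow (rec-var zero) (rec-skip (rec-skip rφ)))
                                         (rec-var (suc zero))
                                         (rec-if (rec-skip rφ) (rec-var zero) rec-0)))
              λ { (k ∷ x) → primRec-minBelow k x })
    rb
  where
  primRec-minBelow : ∀ k x →
    primRec (λ _ → 0) (λ v → if anyBelow (lookup v zero) (λ i → φ (i ∷ tail (tail v)))
                             then lookup v (suc zero)
                             else (if φ (head v ∷ tail (tail v)) then lookup v zero else 0)) k x
      ≡ minBelow k (λ i → φ (i ∷ x))
  primRec-minBelow zero    x = refl
  primRec-minBelow (suc k) x rewrite primRec-minBelow k x = refl

-- Pairing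

-- Opaque, since unfolding pairings inside the goals of the certificate checker below makes
-- their normal forms explode; only the stated properties are used.
opaque
  pair : ℕ → ℕ → ℕ
  pair a b = (a + b) * (a + b) + a

  ≤-pairˡ : ∀ a b → a ≤ pair a b
  ≤-pairˡ a b = m≤n+m a _

  ≤-pairʳ : ∀ a b → b ≤ pair a b
  ≤-pairʳ a b = ≤-trans (m≤n+m b a) (≤-trans (m≤m*m (a + b)) (m≤m+n _ a))
    where
    m≤m*m : ∀ m → m ≤ m * m
    m≤m*m zero    = z≤n
    m≤m*m (suc m) = m≤m*n (suc m) (suc m)

  -- Pairs with a smaller sum s come first, as s * s + a ≤ s * s + s < (s + 1) * (s + 1).
  pair-<-sum : ∀ {a b c d} → a + b < c + d → pair a b < pair c d
  pair-<-sum {a} {b} {c} {d} lt = begin-strict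
    (a + b) * (a + b) + a          ≤⟨ +-monoʳ-≤ ((a + b) * (a + b)) (m≤m+n a b) ⟩
    (a + b) * (a + b) + (a + b)    <⟨ s≤s (≤-reflexive (trans (+-comm ((a + b) * (a + b)) (a + b))
                                                               (sym (*-suc (a + b) (a + b))))) ⟩
    suc ((a + b) * suc (a + b))    ≤⟨ s≤s (m≤n+m _ (a + b)) ⟩
    suc (a + b) * suc (a + b)      ≤⟨ *-mono-≤ lt lt ⟩
    (c + d) * (c + d)              ≤⟨ m≤m+n _ c ⟩
    (c + d) * (c + d) + c          ∎
    where open ≤-Reasoning

  pair-injective : ∀ {a b c d} → pair a b ≡ pair c d → a ≡ c × b ≡ d
  pair-injective {a} {b} {c} {d} eq with <-cmp (a + b) (c + d)
  ... | tri< lt _ _ = ⊥-elim (<-irrefl eq (pair-<-sum {a} {b} {c} {d} lt))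
  ... | tri> _ _ gt = ⊥-elim (<-irrefl (sym eq) (pair-<-sum {c} {d} {a} {b} gt))
  ... | tri≈ _ same _ = a≡c , +-cancelˡ-≡ c b d (subst (λ z → z + b ≡ c + d) a≡c same)
    where
    a≡c : a ≡ c
    a≡c = +-cancelˡ-≡ ((a + b) * (a + b)) a c (trans eq (cong (λ s → s * s + c) (sym same)))

  rec-pair : ∀ {n} {f g : Vec ℕ n → ℕ} → Recursive f → Recursive g → Recursive (λ x → pair (f x) (g x))
  rec-pair rf rg = rec-+ (rec-* (rec-+ rf rg) (rec-+ rf rg)) rf

opaque
  unpair₁ : ℕ → ℕ
  unpair₁ z = minBelow (suc z) (λ a → anyBelow (suc z) (λ b → pair a b ≡ᵇ z))

  unpair₂ : ℕ → ℕ
  unpair₂ z = minBelow (suc z) (λ b → anyBelow (suc z) (λ a → pair a b ≡ᵇ z))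

  unpair₁-pair : ∀ a b → unpair₁ (pair a b) ≡ a
  unpair₁-pair a b = minBelow-≡ (λ a′ → anyBelow (suc (pair a b)) (λ b′ → pair a′ b′ ≡ᵇ pair a b))
    (s≤s (≤-pairˡ a b))
    (anyBelow⁺ (λ b′ → pair a b′ ≡ᵇ pair a b) (s≤s (≤-pairʳ a b)) (≡⇒≡ᵇ (pair a b) (pair a b) refl))
    λ a′ a′<a t → let b′ , _ , e = anyBelow⁻ (suc (pair a b)) _ t in
      <-irrefl (proj₁ (pair-injective {a′} {b′} {a} {b} (≡ᵇ⇒≡ (pair a′ b′) (pair a b) e))) a′<a

  unpair₂-pair : ∀ a b → unpair₂ (pair a b) ≡ b
  unpair₂-pair a b = minBelow-≡ (λ b′ → anyBelow (suc (pair a b)) (λ a′ → pair a′ b′ ≡ᵇ pair a b))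
    (s≤s (≤-pairʳ a b))
    (anyBelow⁺ (λ a′ → pair a′ b ≡ᵇ pair a b) (s≤s (≤-pairˡ a b)) (≡⇒≡ᵇ (pair a b) (pair a b) refl))
    λ b′ b′<b t → let a′ , _ , e = anyBelow⁻ (suc (pair a b)) _ t in
      <-irrefl (proj₂ (pair-injective {a′} {b′} {a} {b} (≡ᵇ⇒≡ (pair a′ b′) (pair a b) e))) b′<b

  unpair₂-≤ : ∀ z → unpair₂ z ≤ z
  unpair₂-≤ z = minBelow-≤ z _

  rec-unpair₁ : ∀ {n} {f : Vec ℕ n → ℕ} → Recursive f → Recursive (λ x → unpair₁ (f x))
  rec-unpair₁ rf = rec-minBelow (rec-suc rf)
    (recB-anyBelow (rec-suc (rec-tail rf))
                   (recB-≡ᵇ (rec-pair (rec-var (suc zero)) (rec-var zero)) (rec-tail (rec-tail rf))))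

  rec-unpair₂ : ∀ {n} {f : Vec ℕ n → ℕ} → Recursive f → Recursive (λ x → unpair₂ (f x))
  rec-unpair₂ rf = rec-minBelow (rec-suc rf)
    (recB-anyBelow (rec-suc (rec-tail rf))
                   (recB-≡ᵇ (rec-pair (rec-var zero) (rec-var (suc zero))) (rec-tail (rec-tail rf))))

-- Lists coded as numbers

cons : ℕ → ℕ → ℕ
cons h t = suc (pair h t)

hd : ℕ → ℕ
hd z = unpair₁ (pred z)

tl : ℕ → ℕ
tl z = unpair₂ (pred z)

hd-cons : ∀ h t → hd (cons h t) ≡ h
hd-cons = unpair₁-pair

tl-cons : ∀ h t → tl (cons h t) ≡ t
tl-cons = unpair₂-pair

tl-0 : tl 0 ≡ 0
tl-0 = n≤0⇒n≡0 (unpair₂-≤ 0)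

tl-< : ∀ {w} → w ≢ 0 → tl w < w
tl-< {zero}  w≢0 = ⊥-elim (w≢0 refl)
tl-< {suc w} _   = s≤s (unpair₂-≤ w)

drop : ℕ → ℕ → ℕ
drop k z = iterate tl z k

drop-0 : ∀ k → drop k 0 ≡ 0
drop-0 zero    = refl
drop-0 (suc k) = trans (cong (drop k) tl-0) (drop-0 k)

drop-+-≤ : ∀ k S → drop k S ≢ 0 → k + drop k S ≤ S
drop-+-≤ zero    S _   = ≤-refl
drop-+-≤ (suc k) S ne  = begin
  suc k + drop k (tl S)  ≤⟨ s≤s (drop-+-≤ k (tl S) ne) ⟩
  suc (tl S)             ≤⟨ tl-< S≢0 ⟩
  S                      ∎
  where
  open ≤-Reasoning
  S≢0 : S ≢ 0
  S≢0 refl = ne (drop-0 (suc k))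

drop-< : ∀ k S → drop k S ≢ 0 → k < S
drop-< k S ne = <-≤-trans (m<m+n k (n≢0⇒n>0 ne)) (drop-+-≤ k S ne)

encodeList : List ℕ → ℕ
encodeList []      = 0
encodeList (t ∷ L) = cons t (encodeList L)

encodeVec : ∀ {n} → Vec ℕ n → ℕ
encodeVec []      = 0
encodeVec (t ∷ v) = cons t (encodeVec v)

hd-drop-encodeVec : ∀ {n} (x : Vec ℕ n) i → hd (drop (toℕ i) (encodeVec x)) ≡ lookup x i
hd-drop-encodeVec (a ∷ x) zero    = hd-cons a (encodeVec x)
hd-drop-encodeVec (a ∷ x) (suc i) rewrite tl-cons a (encodeVec x) = hd-drop-encodeVec x i

infix 4 _∈ᴺ_

_∈ᴺ_ : ℕ → ℕ → Set
t ∈ᴺ S = ∃[ k ] drop k S ≢ 0 × hd (drop k S) ≡ t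

elemᴺ : ℕ → ℕ → Bool
elemᴺ t S = anyBelow S (λ k → not (drop k S ≡ᵇ 0) ∧ (hd (drop k S) ≡ᵇ t))

elemᴺ⁻ : ∀ t S → T (elemᴺ t S) → t ∈ᴺ S
elemᴺ⁻ t S m =
  let k , _ , p = anyBelow⁻ S _ m ; nonempty , head≡ = to (T-∧ {not (drop k S ≡ᵇ 0)}) p in
  k , ≢-nonZero⁻¹ _ {{record { nonZero = nonempty }}} , ≡ᵇ⇒≡ _ t head≡

elemᴺ⁺ : ∀ t S → t ∈ᴺ S → T (elemᴺ t S)
elemᴺ⁺ t S (k , ne , head≡) =
  anyBelow⁺ _ (drop-< k S ne) (from T-∧ (NonZero.nonZero (≢-nonZero ne) , ≡⇒≡ᵇ _ t head≡))

∈ᴺ-cons⁺ : ∀ {t} u S → t ∈ᴺ S → t ∈ᴺ cons u S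
∈ᴺ-cons⁺ u S t∈S = let k , ne , head≡ = subst (_ ∈ᴺ_) (sym (tl-cons u S)) t∈S in suc k , ne , head≡

∈ᴺ-cons⁻ : ∀ {t} u S → t ∈ᴺ cons u S → t ≡ u ⊎ t ∈ᴺ S
∈ᴺ-cons⁻ u S (zero  , _  , head≡) = inj₁ (trans (sym head≡) (hd-cons u S))
∈ᴺ-cons⁻ u S (suc k , ne , head≡) = inj₂ (subst (_ ∈ᴺ_) (tl-cons u S) (k , ne , head≡))

∈ᴺ-encodeList⁺ : ∀ {t L} → t ∈ L → t ∈ᴺ encodeList L
∈ᴺ-encodeList⁺ {L = u ∷ L} (here refl) = 0 , (λ ()) , hd-cons u (encodeList L)
∈ᴺ-encodeList⁺ {L = u ∷ L} (there t∈L) = ∈ᴺ-cons⁺ u (encodeList L) (∈ᴺ-encodeList⁺ t∈L)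

∈ᴺ-encodeList⁻ : ∀ {t} L → t ∈ᴺ encodeList L → t ∈ L
∈ᴺ-encodeList⁻ []      (k , ne , _) = ⊥-elim (ne (drop-0 k))
∈ᴺ-encodeList⁻ (u ∷ L) t∈S with ∈ᴺ-cons⁻ u (encodeList L) t∈S
... | inj₁ refl = here refl
... | inj₂ t∈L  = there (∈ᴺ-encodeList⁻ L t∈L)

∈⇒≤-encodeList : ∀ {t L} → t ∈ L → t ≤ encodeList L
∈⇒≤-encodeList {t} {u ∷ L} (here refl) = m≤n⇒m≤1+n (≤-pairˡ t (encodeList L))
∈⇒≤-encodeList {t} {u ∷ L} (there t∈L) =
  ≤-trans (∈⇒≤-encodeList t∈L) (m≤n⇒m≤1+n (≤-pairʳ u (encodeList L)))

rec-cons : ∀ {n} {f g : Vec ℕ n → ℕ} → Recursive f → Recursive g → Recursive (λ x → cons (f x) (g x))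
rec-cons rf rg = rec-suc (rec-pair rf rg)

rec-hd : ∀ {n} {f : Vec ℕ n → ℕ} → Recursive f → Recursive (λ x → hd (f x))
rec-hd rf = rec-unpair₁ (rec-pred rf)

rec-tl : ∀ {n} {f : Vec ℕ n → ℕ} → Recursive f → Recursive (λ x → tl (f x))
rec-tl rf = rec-unpair₂ (rec-pred rf)

rec-drop : ∀ {n} {k z : Vec ℕ n → ℕ} → Recursive k → Recursive z → Recursive (λ x → drop (k x) (z x))
rec-drop {k = k} {z} rk rz =
  rec-cong (rec-fold (rec-tl (rec-var zero)) rz rk) λ x → iterate-is-fold (z x) tl (k x)

recB-elemᴺ : ∀ {n} {t S : Vec ℕ n → ℕ} → Recursive t → Recursive S → RecursiveB (λ x → elemᴺ (t x) (S x))
recB-elemᴺ {S = S} rt rS =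
  recB-anyBelow rS (recB-∧ (recB-not (recB-≡ᵇ entry rec-0)) (recB-≡ᵇ (rec-hd entry) (rec-tail rt)))
  where
  entry : Recursive (λ v → drop (lookup v zero) (S (tail v)))
  entry = rec-drop (rec-var zero) (rec-tail rS)

rec-encodeVec : ∀ n → Recursive (λ (x : Vec ℕ n) → encodeVec x)
rec-encodeVec zero    = rec-cong rec-0 λ { [] → refl }
rec-encodeVec (suc n) = rec-cong (rec-cons (rec-var zero) (rec-tail (rec-encodeVec n))) λ { (_ ∷ _) → refl }

-- Evaluation certificates

mutual
  ⟦⟧↓-deterministic : ∀ {n} {e : Code n} {x y₁ y₂} → e ⟦ x ⟧↓ y₁ → e ⟦ x ⟧↓ y₂ → y₁ ≡ y₂
  ⟦⟧↓-deterministic ev-zer ev-zer = refl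
  ⟦⟧↓-deterministic ev-succ ev-succ = refl
  ⟦⟧↓-deterministic ev-proj ev-proj = refl
  ⟦⟧↓-deterministic (ev-comp gs⇓₁ f↓₁) (ev-comp gs⇓₂ f↓₂) with ⟦⟧↓*-deterministic gs⇓₁ gs⇓₂
  ... | refl = ⟦⟧↓-deterministic f↓₁ f↓₂
  ⟦⟧↓-deterministic (ev-prec-zero g↓₁) (ev-prec-zero g↓₂) = ⟦⟧↓-deterministic g↓₁ g↓₂
  ⟦⟧↓-deterministic (ev-prec-suc rec↓₁ s↓₁) (ev-prec-suc rec↓₂ s↓₂) with ⟦⟧↓-deterministic rec↓₁ rec↓₂
  ... | refl = ⟦⟧↓-deterministic s↓₁ s↓₂
  ⟦⟧↓-deterministic (ev-mu {y = y₁} f↓₁ below₁) (ev-mu {y = y₂} f↓₂ below₂) with <-cmp y₁ y₂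
  ... | tri< y₁<y₂ _ _ = ⊥-elim (0≢1+n (⟦⟧↓-deterministic f↓₁ (proj₂ (below₂ y₁ y₁<y₂))))
  ... | tri≈ _ y₁≡y₂ _ = y₁≡y₂
  ... | tri> _ _ y₂<y₁ = ⊥-elim (0≢1+n (⟦⟧↓-deterministic f↓₂ (proj₂ (below₁ y₂ y₂<y₁))))

  ⟦⟧↓*-deterministic : ∀ {m n} {gs : Vec (Code n) m} {x ys₁ ys₂} → gs ⟦ x ⟧↓* ys₁ → gs ⟦ x ⟧↓* ys₂ → ys₁ ≡ ys₂
  ⟦⟧↓*-deterministic ev-[] ev-[] = refl
  ⟦⟧↓*-deterministic (ev-∷ g↓₁ gs⇓₁) (ev-∷ g↓₂ gs⇓₂) =
    cong₂ _∷_ (⟦⟧↓-deterministic g↓₁ g↓₂) (⟦⟧↓*-deterministic gs⇓₁ gs⇓₂)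

-- Tag 6 is reserved for the argument lists of compositions.
mutual
  ⌜_⌝ : ∀ {n} → Code n → ℕ
  ⌜ zer ⌝       = pair 0 0
  ⌜ succ ⌝      = pair 1 0
  ⌜ proj i ⌝    = pair 2 (toℕ i)
  ⌜ comp f gs ⌝ = pair 3 (pair ⌜ f ⌝ ⌜ gs ⌝*)
  ⌜ prec g s ⌝  = pair 4 (pair ⌜ g ⌝ ⌜ s ⌝)
  ⌜ mu f ⌝      = pair 5 ⌜ f ⌝

  ⌜_⌝* : ∀ {m n} → Vec (Code n) m → ℕ
  ⌜ [] ⌝*     = 0
  ⌜ g ∷ gs ⌝* = cons ⌜ g ⌝ ⌜ gs ⌝*

-- claim e x y asserts that the program coded by e maps the coded input list x to y.
claim : ℕ → ℕ → ℕ → ℕ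
claim e x y = pair e (pair x y)

-- Rule tag a x y M: claim (pair tag a) x y follows by one evaluation rule from claims in M.
Rule : ℕ → ℕ → ℕ → ℕ → (ℕ → Set) → Set
Rule 0 a x y M = y ≡ 0
Rule 1 a x y M = y ≡ suc (hd x)
Rule 2 a x y M = y ≡ hd (drop a x)
Rule 3 a x y M = ∃[ ys ] M (claim (unpair₁ a) ys y) × M (claim (pair 6 (unpair₂ a)) x ys)
Rule 4 a x y M =
  (hd x ≡ 0 × M (claim (unpair₁ a) (tl x) y)) ⊎
  (hd x ≢ 0 × ∃[ r ] M (claim (pair 4 a) (cons (pred (hd x)) (tl x)) r)
                   × M (claim (unpair₂ a) (cons (pred (hd x)) (cons r (tl x))) y))
Rule 5 a x y M = M (claim a (cons y x) 0) × (∀ z → z < y → ∃[ v ] M (claim a (cons z x) (suc v)))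
Rule 6 a x y M =
  (a ≡ 0 × y ≡ 0) ⊎
  (a ≢ 0 × M (claim (hd a) x (hd y)) × M (claim (pair 6 (tl a)) x (tl y)) × y ≡ cons (hd y) (tl y))
Rule _ a x y M = ⊥

Rule-mono : ∀ tag {a x y} {M M′ : ℕ → Set} → (∀ {t} → M t → M′ t) → Rule tag a x y M → Rule tag a x y M′
Rule-mono 0 f r = r
Rule-mono 1 f r = r
Rule-mono 2 f r = r
Rule-mono 3 f (ys , p , q) = ys , f p , f q
Rule-mono 4 f (inj₁ (e , p)) = inj₁ (e , f p)
Rule-mono 4 f (inj₂ (e , r , p , q)) = inj₂ (e , r , f p , f q)
Rule-mono 5 f (p , h) = f p , λ z z<y → let v , q = h z z<y in v , f q
Rule-mono 6 f (inj₁ e) = inj₁ e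
Rule-mono 6 f (inj₂ (e , p , q , r)) = inj₂ (e , f p , f q , r)
Rule-mono (suc (suc (suc (suc (suc (suc (suc _))))))) f ()

-- The decidable version of Rule for M = (_∈ᴺ S): every witness lies below S.

compᵇ : ℕ → ℕ → ℕ → ℕ → Bool
compᵇ a x y S =
  anyBelow (suc S) λ ys → elemᴺ (claim (unpair₁ a) ys y) S ∧ elemᴺ (claim (pair 6 (unpair₂ a)) x ys) S

precᵇ : ℕ → ℕ → ℕ → ℕ → Bool
precᵇ a x y S =
  if hd x ≡ᵇ 0 then elemᴺ (claim (unpair₁ a) (tl x) y) S
  else anyBelow (suc S) λ r → elemᴺ (claim (pair 4 a) (cons (pred (hd x)) (tl x)) r) S
                           ∧ elemᴺ (claim (unpair₂ a) (cons (pred (hd x)) (cons r (tl x))) y) S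

muᵇ : ℕ → ℕ → ℕ → ℕ → Bool
muᵇ a x y S =
  elemᴺ (claim a (cons y x) 0) S ∧ allBelow y λ z → anyBelow (suc S) λ v → elemᴺ (claim a (cons z x) (suc v)) S

codesᵇ : ℕ → ℕ → ℕ → ℕ → Bool
codesᵇ a x y S =
  if a ≡ᵇ 0 then y ≡ᵇ 0
  else elemᴺ (claim (hd a) x (hd y)) S ∧ elemᴺ (claim (pair 6 (tl a)) x (tl y)) S ∧ (y ≡ᵇ cons (hd y) (tl y))

ruleᵇ : ℕ → ℕ → ℕ → ℕ → ℕ → Bool
ruleᵇ tag a x y S =
  if tag ≡ᵇ 0 then y ≡ᵇ 0 else
  if tag ≡ᵇ 1 then y ≡ᵇ suc (hd x) else
  if tag ≡ᵇ 2 then y ≡ᵇ hd (drop a x) else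
  if tag ≡ᵇ 3 then compᵇ a x y S else
  if tag ≡ᵇ 4 then precᵇ a x y S else
  if tag ≡ᵇ 5 then muᵇ a x y S else
  if tag ≡ᵇ 6 then codesᵇ a x y S else false

elemᴺ-∧⁻ : ∀ {t u} S → T (elemᴺ t S ∧ elemᴺ u S) → t ∈ᴺ S × u ∈ᴺ S
elemᴺ-∧⁻ {t} {u} S p = let p₁ , p₂ = to (T-∧ {elemᴺ t S}) p in elemᴺ⁻ t S p₁ , elemᴺ⁻ u S p₂

ruleᵇ-sound : ∀ tag a x y S → T (ruleᵇ tag a x y S) → Rule tag a x y (_∈ᴺ S)
ruleᵇ-sound 0 a x y S p = ≡ᵇ⇒≡ y 0 p
ruleᵇ-sound 1 a x y S p = ≡ᵇ⇒≡ y _ p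
ruleᵇ-sound 2 a x y S p = ≡ᵇ⇒≡ y _ p
ruleᵇ-sound 3 a x y S p = let ys , _ , q = anyBelow⁻ (suc S) _ p in ys , elemᴺ-∧⁻ S q
ruleᵇ-sound 4 a x y S p with hd x ≡ᵇ 0 in hd≡0
... | true  = inj₁ (≡ᵇ⇒≡ (hd x) 0 (subst T (sym hd≡0) _) , elemᴺ⁻ _ S p)
... | false = let r , _ , q = anyBelow⁻ (suc S) _ p in
  inj₂ ((λ e → subst T hd≡0 (≡⇒≡ᵇ (hd x) 0 e)) , r , elemᴺ-∧⁻ S q)
ruleᵇ-sound 5 a x y S p =
  let p₀ , p< = to (T-∧ {elemᴺ (claim a (cons y x) 0) S}) p in
  elemᴺ⁻ _ S p₀ , λ z z<y → let v , _ , q = anyBelow⁻ (suc S) _ (allBelow⁻ _ p< z z<y) in v , elemᴺ⁻ _ S q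
ruleᵇ-sound 6 a x y S p with a ≡ᵇ 0 in a≡0
... | true  = inj₁ (≡ᵇ⇒≡ a 0 (subst T (sym a≡0) _) , ≡ᵇ⇒≡ y 0 p)
... | false =
  let p₁ , p₂ = to (T-∧ {elemᴺ (claim (hd a) x (hd y)) S}) p
      p₂₁ , p₂₂ = to (T-∧ {elemᴺ (claim (pair 6 (tl a)) x (tl y)) S}) p₂ in
  inj₂ ((λ e → subst T a≡0 (≡⇒≡ᵇ a 0 e)) , elemᴺ⁻ _ S p₁ , elemᴺ⁻ _ S p₂₁ , ≡ᵇ⇒≡ y _ p₂₂)
ruleᵇ-sound (suc (suc (suc (suc (suc (suc (suc _))))))) a x y S ()

≤-claim₂ : ∀ e x y → x ≤ claim e x y
≤-claim₂ e x y = ≤-trans (≤-pairˡ x y) (≤-pairʳ e (pair x y))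

≤-claim₃ : ∀ e x y → y ≤ claim e x y
≤-claim₃ e x y = ≤-trans (≤-pairʳ x y) (≤-pairʳ e (pair x y))

elemᴺ-encodeList : ∀ {t L} → t ∈ L → T (elemᴺ t (encodeList L))
elemᴺ-encodeList {t} {L} t∈L = elemᴺ⁺ t (encodeList L) (∈ᴺ-encodeList⁺ t∈L)

elemᴺ-∧-encodeList : ∀ {t u L} → t ∈ L → u ∈ L → T (elemᴺ t (encodeList L) ∧ elemᴺ u (encodeList L))
elemᴺ-∧-encodeList t∈L u∈L = from T-∧ (elemᴺ-encodeList t∈L , elemᴺ-encodeList u∈L)

<-encodeList : ∀ {L w} t → w ≤ t → t ∈ L → w < suc (encodeList L)
<-encodeList t w≤t t∈L = s≤s (≤-trans w≤t (∈⇒≤-encodeList t∈L))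

ruleᵇ-complete : ∀ tag a x y L → Rule tag a x y (_∈ L) → T (ruleᵇ tag a x y (encodeList L))
ruleᵇ-complete 0 a x y L r = ≡⇒≡ᵇ y 0 r
ruleᵇ-complete 1 a x y L r = ≡⇒≡ᵇ y _ r
ruleᵇ-complete 2 a x y L r = ≡⇒≡ᵇ y _ r
ruleᵇ-complete 3 a x y L (ys , p , q) =
  anyBelow⁺ _ (<-encodeList _ (≤-claim₂ (unpair₁ a) ys y) p) (elemᴺ-∧-encodeList p q)
ruleᵇ-complete 4 a x y L (inj₁ (hd≡0 , p)) rewrite hd≡0 = elemᴺ-encodeList p
ruleᵇ-complete 4 a x y L (inj₂ (hd≢0 , r , p , q)) with hd x ≡ᵇ 0 in hd≡0
... | true  = ⊥-elim (hd≢0 (≡ᵇ⇒≡ (hd x) 0 (subst T (sym hd≡0) _)))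
... | false = anyBelow⁺ _ (<-encodeList _ (≤-claim₃ (pair 4 a) _ r) p) (elemᴺ-∧-encodeList p q)
ruleᵇ-complete 5 a x y L (p , h) =
  from T-∧ (elemᴺ-encodeList p , allBelow⁺ y _ λ z z<y →
    let v , q = h z z<y in
    anyBelow⁺ _ (<-encodeList _ (≤-trans (n≤1+n v) (≤-claim₃ a (cons z x) (suc v))) q) (elemᴺ-encodeList q))
ruleᵇ-complete 6 a x y L (inj₁ (refl , y≡0)) = ≡⇒≡ᵇ y 0 y≡0
ruleᵇ-complete 6 a x y L (inj₂ (a≢0 , p , q , y≡)) with a ≡ᵇ 0 in a≡0
... | true  = ⊥-elim (a≢0 (≡ᵇ⇒≡ a 0 (subst T (sym a≡0) _)))
... | false = from T-∧ (elemᴺ-encodeList p , from T-∧ (elemᴺ-encodeList q , ≡⇒≡ᵇ y _ y≡))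
ruleᵇ-complete (suc (suc (suc (suc (suc (suc (suc _))))))) a x y L ()

follows : ℕ → ℕ → Bool
follows t S = ruleᵇ (unpair₁ (unpair₁ t)) (unpair₂ (unpair₁ t)) (unpair₁ (unpair₂ t)) (unpair₂ (unpair₂ t)) S

follows-claim : ∀ tag a x y S → follows (claim (pair tag a) x y) S ≡ ruleᵇ tag a x y S
follows-claim tag a x y S
  rewrite unpair₁-pair (pair tag a) (pair x y) | unpair₂-pair (pair tag a) (pair x y)
        | unpair₁-pair tag a | unpair₂-pair tag a | unpair₁-pair x y | unpair₂-pair x y = refl

-- Every entry of the coded list S follows from entries of S; entries sit at positions below S,
-- and positions beyond the end read 0.
valid : ℕ → Bool
valid S = allBelow S λ k → (drop k S ≡ᵇ 0) ∨ follows (hd (drop k S)) S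

valid⇒Rule : ∀ {tag a x y S} → T (valid S) → claim (pair tag a) x y ∈ᴺ S → Rule tag a x y (_∈ᴺ S)
valid⇒Rule {tag} {a} {x} {y} {S} v (k , ne , head≡)
  with to (T-∨ {drop k S ≡ᵇ 0}) (allBelow⁻ _ v k (drop-< k S ne))
... | inj₁ empty  = ⊥-elim (ne (≡ᵇ⇒≡ _ 0 empty))
... | inj₂ follow = ruleᵇ-sound tag a x y S
  (subst T (follows-claim tag a x y S) (subst (λ t → T (follows t S)) head≡ follow))

mutual
  valid-sound : ∀ {n} {e : Code n} {x y S} → T (valid S) → claim ⌜ e ⌝ (encodeVec x) y ∈ᴺ S → e ⟦ x ⟧↓ y
  valid-sound {e = zer} v m with valid⇒Rule v m
  ... | refl = ev-zer
  valid-sound {e = succ} {k ∷ []} v m with valid⇒Rule v m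
  ... | refl rewrite hd-cons k 0 = ev-succ
  valid-sound {e = proj i} {x} v m with valid⇒Rule v m
  ... | refl rewrite hd-drop-encodeVec x i = ev-proj
  valid-sound {e = comp f gs} v m with valid⇒Rule v m
  ... | ys , f↓ , gs↓ rewrite unpair₁-pair ⌜ f ⌝ ⌜ gs ⌝* | unpair₂-pair ⌜ f ⌝ ⌜ gs ⌝*
    with valid-sound* v gs↓
  ... | zs , refl , gs⇓ = ev-comp gs⇓ (valid-sound v f↓)
  valid-sound {e = prec g s} {k ∷ x} v m = valid-sound-prec k v m
  valid-sound {e = mu f} v m with valid⇒Rule v m
  ... | f↓0 , f↓suc = ev-mu (valid-sound v f↓0) λ z z<y → let w , p = f↓suc z z<y in w , valid-sound v p

  valid-sound-prec : ∀ {n} {g : Code n} {s x y S} k → T (valid S) →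
                     claim ⌜ prec g s ⌝ (encodeVec (k ∷ x)) y ∈ᴺ S → prec g s ⟦ k ∷ x ⟧↓ y
  valid-sound-prec {g = g} {s} {x} zero v m with valid⇒Rule v m
  ... | inj₁ (_ , g↓) rewrite unpair₁-pair ⌜ g ⌝ ⌜ s ⌝ | tl-cons 0 (encodeVec x) =
    ev-prec-zero (valid-sound v g↓)
  ... | inj₂ (hd≢0 , _) = ⊥-elim (hd≢0 (hd-cons 0 (encodeVec x)))
  valid-sound-prec {g = g} {s} {x} (suc k) v m with valid⇒Rule v m
  ... | inj₁ (hd≡0 , _) with () ← trans (sym (hd-cons (suc k) (encodeVec x))) hd≡0
  ... | inj₂ (_ , r , rec↓ , s↓)
    rewrite hd-cons (suc k) (encodeVec x) | tl-cons (suc k) (encodeVec x) | unpair₂-pair ⌜ g ⌝ ⌜ s ⌝ =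
    ev-prec-suc (valid-sound-prec k v rec↓) (valid-sound v s↓)

  valid-sound* : ∀ {m n} {gs : Vec (Code n) m} {x ys S} → T (valid S) →
                 claim (pair 6 ⌜ gs ⌝*) (encodeVec x) ys ∈ᴺ S → ∃[ zs ] encodeVec zs ≡ ys × gs ⟦ x ⟧↓* zs
  valid-sound* {gs = []} v m with valid⇒Rule v m
  ... | inj₁ (_ , refl) = [] , refl , ev-[]
  ... | inj₂ (0≢0 , _) = ⊥-elim (0≢0 refl)
  valid-sound* {gs = g ∷ gs} {ys = ys} v m with valid⇒Rule v m
  ... | inj₂ (_ , g↓ , gs↓ , ys≡) rewrite hd-cons ⌜ g ⌝ ⌜ gs ⌝* | tl-cons ⌜ g ⌝ ⌜ gs ⌝*
    with valid-sound* v gs↓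
  ... | zs , zs≡ , gs⇓ = hd ys ∷ zs , trans (cong (cons (hd ys)) zs≡) (sym ys≡) , ev-∷ (valid-sound v g↓) gs⇓

Justified : ℕ → (ℕ → Set) → Set
Justified t M = ∃[ tag ] ∃[ a ] ∃[ x ] ∃[ y ] t ≡ claim (pair tag a) x y × Rule tag a x y M

Closed : List ℕ → Set
Closed L = ∀ {t} → t ∈ L → Justified t (_∈ L)

Certificate : ℕ → Set
Certificate t = ∃[ L ] Closed L × t ∈ L

Justified-mono : ∀ {t L L′} → L ⊆ L′ → Justified t (_∈ L) → Justified t (_∈ L′)
Justified-mono L⊆L′ (tag , a , x , y , t≡ , r) = tag , a , x , y , t≡ , Rule-mono tag L⊆L′ r

closed-++ : ∀ {L₁ L₂} → Closed L₁ → Closed L₂ → Closed (L₁ ++ L₂)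
closed-++ {L₁} c₁ c₂ t∈ with ∈-++⁻ L₁ t∈
... | inj₁ t∈L₁ = Justified-mono ∈-++⁺ˡ (c₁ t∈L₁)
... | inj₂ t∈L₂ = Justified-mono (∈-++⁺ʳ L₁) (c₂ t∈L₂)

closed-valid : ∀ L → Closed L → T (valid (encodeList L))
closed-valid L c = allBelow⁺ S _ λ k _ → entry-ok k (drop k S ≟ 0)
  where
  S : ℕ
  S = encodeList L
  entry-ok : ∀ k → Dec (drop k S ≡ 0) → T ((drop k S ≡ᵇ 0) ∨ follows (hd (drop k S)) S)
  entry-ok k (yes empty) = from T-∨ (inj₁ (≡⇒≡ᵇ _ 0 empty))
  entry-ok k (no ne) with c (∈ᴺ-encodeList⁻ L (k , ne , refl))
  ... | tag , a , x , y , t≡ , r = from T-∨ (inj₂ (subst (λ t → T (follows t S)) (sym t≡)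
    (subst T (sym (follows-claim tag a x y S)) (ruleᵇ-complete tag a x y L r))))

certify : ∀ tag {a x y} L → Closed L → Rule tag a x y (_∈ L) → Certificate (claim (pair tag a) x y)
certify tag {a} {x} {y} L c r = claim (pair tag a) x y ∷ L , closed , here refl
  where
  closed : Closed (claim (pair tag a) x y ∷ L)
  closed (here refl) = tag , a , x , y , refl , Rule-mono tag there r
  closed (there t∈L) = Justified-mono there (c t∈L)

closed-⋃ : ∀ y {Q : ℕ → List ℕ → Set} → (∀ {z L L′} → L ⊆ L′ → Q z L → Q z L′) →
           (∀ z → z < y → ∃[ L ] Closed L × Q z L) → ∃[ L ] Closed L × (∀ z → z < y → Q z L)
closed-⋃ zero    mono cert = [] , (λ ()) , λ z ()
closed-⋃ (suc y) mono cert =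
  let L₁ , c₁ , q₁ = closed-⋃ y mono (λ z z<y → cert z (m<n⇒m<1+n z<y))
      L₂ , c₂ , q₂ = cert y (n<1+n y)
  in L₁ ++ L₂ , closed-++ c₁ c₂ , λ z z<1+y → [ (λ z<y → mono ∈-++⁺ˡ (q₁ z z<y))
                                              , (λ { refl → mono (∈-++⁺ʳ L₁) q₂ }) ]′ (m<1+n⇒m<n∨m≡n z<1+y)

mutual
  certificate : ∀ {n} {e : Code n} {x y} → e ⟦ x ⟧↓ y → Certificate (claim ⌜ e ⌝ (encodeVec x) y)
  certificate ev-zer = certify 0 [] (λ ()) refl
  certificate (ev-succ {k}) = certify 1 [] (λ ()) (cong suc (sym (hd-cons k 0)))
  certificate {x = x} (ev-proj {i = i}) = certify 2 [] (λ ()) (sym (hd-drop-encodeVec x i))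
  certificate {x = x} {y} (ev-comp {f = f} {gs} {ys = ys} gs⇓ f↓)
    with certificate* gs⇓ | certificate f↓
  ... | L₁ , c₁ , p₁ | L₂ , c₂ , p₂ = certify 3 (L₁ ++ L₂) (closed-++ c₁ c₂) rule
    where
    rule : Rule 3 (pair ⌜ f ⌝ ⌜ gs ⌝*) (encodeVec x) y (_∈ L₁ ++ L₂)
    rule rewrite unpair₁-pair ⌜ f ⌝ ⌜ gs ⌝* | unpair₂-pair ⌜ f ⌝ ⌜ gs ⌝* =
      encodeVec ys , ∈-++⁺ʳ L₁ p₂ , ∈-++⁺ˡ p₁
  certificate {x = 0 ∷ x} {y} (ev-prec-zero {g = g} {s} g↓) with certificate g↓
  ... | L , c , p = certify 4 L c rule
    where
    rule : Rule 4 (pair ⌜ g ⌝ ⌜ s ⌝) (encodeVec (0 ∷ x)) y (_∈ L)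
    rule rewrite hd-cons 0 (encodeVec x) | tl-cons 0 (encodeVec x) | unpair₁-pair ⌜ g ⌝ ⌜ s ⌝ = inj₁ (refl , p)
  certificate {x = suc k ∷ x} {y} (ev-prec-suc {g = g} {s} {r = r} rec↓ s↓)
    with certificate rec↓ | certificate s↓
  ... | L₁ , c₁ , p₁ | L₂ , c₂ , p₂ = certify 4 (L₁ ++ L₂) (closed-++ c₁ c₂) rule
    where
    rule : Rule 4 (pair ⌜ g ⌝ ⌜ s ⌝) (encodeVec (suc k ∷ x)) y (_∈ L₁ ++ L₂)
    rule rewrite hd-cons (suc k) (encodeVec x) | tl-cons (suc k) (encodeVec x) | unpair₂-pair ⌜ g ⌝ ⌜ s ⌝ =
      inj₂ ((λ ()) , r , ∈-++⁺ˡ p₁ , ∈-++⁺ʳ L₁ p₂)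
  certificate {x = x} {y} (ev-mu {f = f} f↓0 f↓suc)
    with certificate f↓0 | closed-⋃ y {Q = λ z L → ∃[ v ] claim ⌜ f ⌝ (cons z (encodeVec x)) (suc v) ∈ L}
                                     (λ L⊆L′ (v , p) → v , L⊆L′ p)
                                     (λ z z<y → let v , f↓ = f↓suc z z<y ; L , c , p = certificate f↓ in
                                                L , c , v , p)
  ... | L₁ , c₁ , p₁ | L₂ , c₂ , p₂ =
    certify 5 (L₁ ++ L₂) (closed-++ c₁ c₂) (∈-++⁺ˡ p₁ , λ z z<y → let v , p = p₂ z z<y in v , ∈-++⁺ʳ L₁ p)

  certificate* : ∀ {m n} {gs : Vec (Code n) m} {x ys} → gs ⟦ x ⟧↓* ys →
                 Certificate (claim (pair 6 ⌜ gs ⌝*) (encodeVec x) (encodeVec ys))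
  certificate* ev-[] = certify 6 [] (λ ()) (inj₁ (refl , refl))
  certificate* {gs = g ∷ gs} {x} {y ∷ ys} (ev-∷ g↓ gs⇓) with certificate g↓ | certificate* gs⇓
  ... | L₁ , c₁ , p₁ | L₂ , c₂ , p₂ = certify 6 (L₁ ++ L₂) (closed-++ c₁ c₂) rule
    where
    rule : Rule 6 ⌜ g ∷ gs ⌝* (encodeVec x) (encodeVec (y ∷ ys)) (_∈ L₁ ++ L₂)
    rule rewrite hd-cons ⌜ g ⌝ ⌜ gs ⌝* | tl-cons ⌜ g ⌝ ⌜ gs ⌝*
               | hd-cons y (encodeVec ys) | tl-cons y (encodeVec ys) =
      inj₂ ((λ ()) , ∈-++⁺ˡ p₁ , ∈-++⁺ʳ L₁ p₂ , refl)

rec-claim : ∀ {n} {e x y : Vec ℕ n → ℕ} → Recursive e → Recursive x → Recursive y →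
            Recursive (λ v → claim (e v) (x v) (y v))
rec-claim re rx ry = rec-pair re (rec-pair rx ry)

module _ {n} {a x y S : Vec ℕ n → ℕ} (ra : Recursive a) (rx : Recursive x) (ry : Recursive y) (rS : Recursive S)
  where

  recB-compᵇ : RecursiveB (λ v → compᵇ (a v) (x v) (y v) (S v))
  recB-compᵇ = recB-anyBelow (rec-suc rS)
    (recB-∧ (recB-elemᴺ (rec-claim (rec-unpair₁ (rec-tail ra)) (rec-var zero) (rec-tail ry)) (rec-tail rS))
            (recB-elemᴺ (rec-claim (rec-pair (rec-const 6) (rec-unpair₂ (rec-tail ra))) (rec-tail rx)
                                   (rec-var zero))
                        (rec-tail rS)))

  recB-precᵇ : RecursiveB (λ v → precᵇ (a v) (x v) (y v) (S v))
  recB-precᵇ = recB-if (recB-≡ᵇ (rec-hd rx) rec-0)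
    (recB-elemᴺ (rec-claim (rec-unpair₁ ra) (rec-tl rx) ry) rS)
    (recB-anyBelow (rec-suc rS)
      (recB-∧ (recB-elemᴺ (rec-claim (rec-pair (rec-const 4) (rec-tail ra))
                                     (rec-cons pred-hd (rec-tl (rec-tail rx)))
                                     (rec-var zero))
                          (rec-tail rS))
              (recB-elemᴺ (rec-claim (rec-unpair₂ (rec-tail ra))
                                     (rec-cons pred-hd (rec-cons (rec-var zero) (rec-tl (rec-tail rx))))
                                     (rec-tail ry))
                          (rec-tail rS))))
    where
    pred-hd : Recursive (λ (v : Vec ℕ (suc n)) → pred (hd (x (tail v))))
    pred-hd = rec-pred (rec-hd (rec-tail rx))

  recB-muᵇ : RecursiveB (λ v → muᵇ (a v) (x v) (y v) (S v))
  recB-muᵇ = recB-∧ (recB-elemᴺ (rec-claim ra (rec-cons ry rx) rec-0) rS)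
    (recB-allBelow ry (recB-anyBelow (rec-suc (rec-tail rS))
      (recB-elemᴺ (rec-claim (rec-tail (rec-tail ra)) (rec-cons (rec-var (suc zero)) (rec-tail (rec-tail rx)))
                             (rec-suc (rec-var zero)))
                  (rec-tail (rec-tail rS)))))

  recB-codesᵇ : RecursiveB (λ v → codesᵇ (a v) (x v) (y v) (S v))
  recB-codesᵇ = recB-if (recB-≡ᵇ ra rec-0) (recB-≡ᵇ ry rec-0)
    (recB-∧ (recB-elemᴺ (rec-claim (rec-hd ra) rx (rec-hd ry)) rS)
      (recB-∧ (recB-elemᴺ (rec-claim (rec-pair (rec-const 6) (rec-tl ra)) rx (rec-tl ry)) rS)
              (recB-≡ᵇ ry (rec-cons (rec-hd ry) (rec-tl ry)))))

  recB-ruleᵇ : ∀ {tag : Vec ℕ n → ℕ} → Recursive tag → RecursiveB (λ v → ruleᵇ (tag v) (a v) (x v) (y v) (S v))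
  recB-ruleᵇ {tag} rtag =
    recB-if (is 0) (recB-≡ᵇ ry rec-0) (
    recB-if (is 1) (recB-≡ᵇ ry (rec-suc (rec-hd rx))) (
    recB-if (is 2) (recB-≡ᵇ ry (rec-hd (rec-drop ra rx))) (
    recB-if (is 3) recB-compᵇ (
    recB-if (is 4) recB-precᵇ (
    recB-if (is 5) recB-muᵇ (
    recB-if (is 6) recB-codesᵇ recB-false))))))
    where
    is : ∀ c → RecursiveB (λ v → tag v ≡ᵇ c)
    is c = recB-≡ᵇ rtag (rec-const c)

recB-follows : ∀ {n} {t S : Vec ℕ n → ℕ} → Recursive t → Recursive S → RecursiveB (λ v → follows (t v) (S v))
recB-follows rt rS =
  recB-ruleᵇ (rec-unpair₂ (rec-unpair₁ rt)) (rec-unpair₁ (rec-unpair₂ rt)) (rec-unpair₂ (rec-unpair₂ rt)) rS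
             (rec-unpair₁ (rec-unpair₁ rt))

recB-valid : ∀ {n} {S : Vec ℕ n → ℕ} → Recursive S → RecursiveB (λ v → valid (S v))
recB-valid {S = S} rS = recB-allBelow rS
  (recB-∨ (recB-≡ᵇ entry rec-0) (recB-follows (rec-hd entry) (rec-tail rS)))
  where
  entry : Recursive (λ v → drop (lookup v zero) (S (tail v)))
  entry = rec-drop (rec-var zero) (rec-tail rS)

-- RE relations from recursive tests

least-or-none : ∀ (f : ℕ → Bool) b →
                (∀ a → a < b → ¬ T (f a)) ⊎ ∃[ a ] T (f a) × (∀ a′ → a′ < a → ¬ T (f a′))
least-or-none f zero    = inj₁ λ a ()
least-or-none f (suc b) with least-or-none f b
... | inj₂ found = inj₂ found
... | inj₁ none with f b in fb
...   | true  = inj₂ (b , subst T (sym fb) _ , none)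
...   | false = inj₁ λ a a<1+b fa → [ (λ a<b → none a a<b fa) , (λ { refl → subst T fb fa }) ]′
                                      (m<1+n⇒m<n∨m≡n a<1+b)

least : ∀ (f : ℕ → Bool) {b} → T (f b) → ∃[ a ] T (f a) × (∀ a′ → a′ < a → ¬ T (f a′))
least f {b} fb = [ (λ none → ⊥-elim (none b (n<1+n b) fb)) , (λ found → found) ]′ (least-or-none f (suc b))

RE-∃ : ∀ {n} (P : Vec ℕ (suc n) → Bool) → RecursiveB P → RE (λ x → ∃[ s ] T (P (s ∷ x)))
RE-∃ {n} P rP = mu e , λ x → mk⇔ (halts x) (witness x)
  where
  indicator : Recursive (λ v → if P v then 0 else 1)
  indicator = rec-if rP (rec-const 0) (rec-const 1)
  e : Code (suc n)
  e = proj₁ indicator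
  e↓ : ∀ v → e ⟦ v ⟧↓ (if P v then 0 else 1)
  e↓ = proj₂ indicator
  e↓-true : ∀ {v} → T (P v) → e ⟦ v ⟧↓ 0
  e↓-true {v} Pv = subst (λ b → e ⟦ v ⟧↓ (if b then 0 else 1)) (to T-≡ Pv) (e↓ v)
  e↓-false : ∀ {v} → ¬ T (P v) → e ⟦ v ⟧↓ 1
  e↓-false {v} ¬Pv with P v in Pv | e↓ v
  ... | true  | _ = ⊥-elim (¬Pv _)
  ... | false | d = d
  halts : ∀ x → ∃[ s ] T (P (s ∷ x)) → ∃[ y ] mu e ⟦ x ⟧↓ y
  halts x (s , Ps) = let a , Pa , below = least (λ s → P (s ∷ x)) Ps in
    a , ev-mu (e↓-true Pa) λ z z<a → 0 , e↓-false (below z z<a)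
  witness : ∀ x → ∃[ y ] mu e ⟦ x ⟧↓ y → ∃[ s ] T (P (s ∷ x))
  witness x (y , ev-mu e↓0 _) with P (y ∷ x) in Py | ⟦⟧↓-deterministic e↓0 (e↓ (y ∷ x))
  ... | true  | _ = y , subst T (sym Py) _
  ... | false | ()

-- Racing searches

race-⇔ : ∀ {C D A B : Set} (h₁ h₂ : ℕ → Bool) →
         (∀ s → T (h₁ s) → C ⊎ B) → (∀ s → T (h₂ s) → D ⊎ A) →
         (C → ∃[ s ] T (h₁ s)) → (A → ∃[ s ] T (h₂ s)) →
         (∃[ s ] T (h₁ s ∧ not (h₂ s)) → A) → (∃[ s ] T (h₂ s ∧ not (h₁ s)) → B) →
         (C → D → ⊥) → (A → B → ⊥) → C ⇔ A
race-⇔ {C} {D} {A} {B} h₁ h₂ sound₁ sound₂ complete₁ complete₂ win₁ win₂ C#D A#B = mk⇔ C→A A→C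
  where
  C→A : C → A
  C→A c with complete₁ c
  ... | s , h₁s with h₂ s in h₂s
  ... | true  = [ (λ d → ⊥-elim (C#D c d)) , (λ a → a) ]′ (sound₂ s (subst T (sym h₂s) _))
  ... | false = win₁ (s , from T-∧ (h₁s , from T-not-≡ h₂s))
  A→C : A → C
  A→C a with complete₂ a
  ... | s , h₂s with h₁ s in h₁s
  ... | true  = [ (λ c → c) , (λ b → ⊥-elim (A#B a b)) ]′ (sound₁ s (subst T (sym h₁s) _))
  ... | false = ⊥-elim (A#B a (win₂ (s , from T-∧ (h₂s , from T-not-≡ h₁s))))

pack : ∀ {m} → ℕ → Vec ℕ (suc m) → Vec ℕ (suc m)
pack j a = pair j (head a) ∷ tail a

recF-pack : ∀ {m} → RecursiveFunctional (λ (v : Vec ℕ (2 + m)) → pack (head v) (tail v))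
recF-pack zero    = rec-cong (rec-pair (rec-var zero) (rec-var (suc zero))) λ { (_ ∷ _ ∷ _) → refl }
recF-pack (suc i) = rec-cong (rec-var (suc (suc i))) λ { (_ ∷ _ ∷ _) → refl }

recF-∘-pack : ∀ {m} (G : Vec ℕ (suc m) → Vec ℕ (suc m)) j → RecursiveFunctional G →
              RecursiveFunctional (λ a → G (pack j a))
recF-∘-pack G j rG k = rec-∘ {G = j ∷_} (rec-∘ {G = λ v → pack (head v) (tail v)} (rG k) recF-pack)
                              λ { zero → rec-const j ; (suc i) → rec-var i }

-- The programs P k receive the list j as an argument instead of containing it, so j can list them.
selfReference : ∀ {m} (G : Vec ℕ (suc m) → Vec ℕ (suc m)) → RecursiveFunctional G →
  ∃[ j ] Σ[ P ∈ (Fin (suc m) → Code (2 + m)) ] (∀ k → hd (drop (toℕ k) j) ≡ ⌜ P k ⌝) ×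
    (∀ k a → P k ⟦ j ∷ a ⟧↓ lookup (G (pack j a)) k)
selfReference {m} G rG = j , P , P-listed , λ k a → proj₂ (rec-P k) (j ∷ a)
  where
  rec-P : ∀ k → Recursive (λ (v : Vec ℕ (2 + m)) → lookup (G (pack (head v) (tail v))) k)
  rec-P k = rec-∘ {G = λ v → pack (head v) (tail v)} (rG k) recF-pack
  P : Fin (suc m) → Code (2 + m)
  P k = proj₁ (rec-P k)
  j : ℕ
  j = encodeVec (tabulate λ k → ⌜ P k ⌝)
  P-listed : ∀ k → hd (drop (toℕ k) j) ≡ ⌜ P k ⌝
  P-listed k = trans (hd-drop-encodeVec (tabulate λ k → ⌜ P k ⌝) k) (lookup∘tabulate (λ k → ⌜ P k ⌝) k)

haltsIn : ℕ → ℕ → ℕ → Bool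
haltsIn c x S = anyBelow (suc S) λ y → elemᴺ (claim c x y) S

outputsIn : ℕ → ℕ → ℕ → ℕ → ℕ → Bool
outputsIn l j x ys S = allBelow l λ k → elemᴺ (claim (hd (drop k j)) x (hd (drop k ys))) S

rebuild : ℕ → ℕ → ℕ
rebuild zero    ys = 0
rebuild (suc l) ys = cons (hd ys) (rebuild l (tl ys))

haltsOnOutputs : ℕ → ℕ → ℕ → ℕ → ℕ → Bool
haltsOnOutputs l j c x S = anyBelow (suc S) λ ys → outputsIn l j (cons j x) ys S ∧ haltsIn c (rebuild l ys) S

stage : ℕ → ℕ → ℕ → ℕ → ℕ → ℕ → Bool
stage l c₁ c₂ j x S = valid S ∧ (haltsIn c₁ x S ∨ haltsOnOutputs l j c₂ x S)

-- The first coordinate of the input x is read as a packed pair of j and of the first entry.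
racer : ∀ {m} → ℕ → ℕ → ℕ → Vec ℕ (suc m) → Bool
racer {m} c₁ c₂ s x =
  anyBelow (suc s) (stage (suc m) c₁ c₂ (unpair₁ (head x)) (cons (unpair₂ (head x)) (encodeVec (tail x))))

Wins : ∀ {m} → ℕ → ℕ → ℕ → ℕ → Rel (suc m)
Wins c₁ c₂ c₃ c₄ x = ∃[ s ] T (racer c₁ c₂ s x ∧ not (racer c₃ c₄ s x))

recB-haltsIn : ∀ {n} c {x S : Vec ℕ n → ℕ} → Recursive x → Recursive S →
               RecursiveB (λ v → haltsIn c (x v) (S v))
recB-haltsIn c rx rS =
  recB-anyBelow (rec-suc rS) (recB-elemᴺ (rec-claim (rec-const c) (rec-tail rx) (rec-var zero)) (rec-tail rS))

recB-outputsIn : ∀ {n} l {j x ys S : Vec ℕ n → ℕ} → Recursive j → Recursive x → Recursive ys → Recursive S →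
                 RecursiveB (λ v → outputsIn l (j v) (x v) (ys v) (S v))
recB-outputsIn l rj rx rys rS = recB-allBelow (rec-const l)
  (recB-elemᴺ (rec-claim (rec-hd (rec-drop (rec-var zero) (rec-tail rj))) (rec-tail rx)
                         (rec-hd (rec-drop (rec-var zero) (rec-tail rys))))
              (rec-tail rS))

rec-rebuild : ∀ {n} l {ys : Vec ℕ n → ℕ} → Recursive ys → Recursive (λ v → rebuild l (ys v))
rec-rebuild zero    rys = rec-0
rec-rebuild (suc l) rys = rec-cons (rec-hd rys) (rec-rebuild l (rec-tl rys))

recB-stage : ∀ {n} l c₁ c₂ {j x S : Vec ℕ n → ℕ} → Recursive j → Recursive x → Recursive S →
             RecursiveB (λ v → stage l c₁ c₂ (j v) (x v) (S v))
recB-stage l c₁ c₂ rj rx rS = recB-∧ (recB-valid rS) (recB-∨ (recB-haltsIn c₁ rx rS)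
  (recB-anyBelow (rec-suc rS)
    (recB-∧ (recB-outputsIn l (rec-tail rj) (rec-cons (rec-tail rj) (rec-tail rx)) (rec-var zero) (rec-tail rS))
            (recB-haltsIn c₂ (rec-rebuild l (rec-var zero)) (rec-tail rS)))))

recB-racer : ∀ {m} c₁ c₂ → RecursiveB (λ (v : Vec ℕ (2 + m)) → racer c₁ c₂ (head v) (tail v))
recB-racer {m} c₁ c₂ = recB-cong
  (recB-anyBelow (rec-suc (rec-var zero))
    (recB-stage (suc m) c₁ c₂ (rec-unpair₁ (rec-var (suc (suc zero))))
                (rec-cons (rec-unpair₂ (rec-var (suc (suc zero))))
                          (rec-tail (rec-tail (rec-tail (rec-encodeVec m)))))
                (rec-var zero)))
  λ { (_ ∷ _ ∷ _) → refl }

RE-Wins : ∀ {m} c₁ c₂ c₃ c₄ → RE (Wins {m} c₁ c₂ c₃ c₄)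
RE-Wins c₁ c₂ c₃ c₄ = RE-∃ _ (recB-∧ (recB-racer c₁ c₂) (recB-not (recB-racer c₃ c₄)))

racer-mono : ∀ {m} c₁ c₂ {s s′} (x : Vec ℕ (suc m)) → s ≤ s′ → T (racer c₁ c₂ s x) → T (racer c₁ c₂ s′ x)
racer-mono c₁ c₂ x s≤s′ = anyBelow-mono _ (s≤s s≤s′)

Wins-disjoint : ∀ {m} c₁ c₂ c₃ c₄ → Disjoint (Wins {m} c₁ c₂ c₃ c₄) (Wins c₃ c₄ c₁ c₂)
Wins-disjoint c₁ c₂ c₃ c₄ x (s₁ , w₁) (s₂ , w₂)
  with to (T-∧ {racer c₁ c₂ s₁ x}) w₁ | to (T-∧ {racer c₃ c₄ s₂ x}) w₂ | ≤-total s₁ s₂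
... | r₁ , _  | _  , ¬r₁ | inj₁ s₁≤s₂ = subst T (to T-not-≡ ¬r₁) (racer-mono c₁ c₂ x s₁≤s₂ r₁)
... | _  , ¬r₃ | r₃ , _ | inj₂ s₂≤s₁ = subst T (to T-not-≡ ¬r₃) (racer-mono c₃ c₄ x s₂≤s₁ r₃)

haltsIn-sound : ∀ {n} (c : Code n) a S → T (valid S) → T (haltsIn ⌜ c ⌝ (encodeVec a) S) → ∃[ y ] c ⟦ a ⟧↓ y
haltsIn-sound c a S v h = let y , _ , y∈ = anyBelow⁻ (suc S) _ h in y , valid-sound v (elemᴺ⁻ _ S y∈)

haltsIn-encodeList : ∀ {c x y L} → claim c x y ∈ L → T (haltsIn c x (encodeList L))
haltsIn-encodeList {c} {x} {y} t∈L = anyBelow⁺ _ (<-encodeList _ (≤-claim₃ c x y) t∈L) (elemᴺ-encodeList t∈L)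

rebuild-encodeVec : ∀ {l} (v : Vec ℕ l) → rebuild l (encodeVec v) ≡ encodeVec v
rebuild-encodeVec []      = refl
rebuild-encodeVec (a ∷ v) rewrite hd-cons a (encodeVec v) | tl-cons a (encodeVec v) =
  cong (cons a) (rebuild-encodeVec v)

rebuild-tabulate : ∀ l ys → rebuild l ys ≡ encodeVec (tabulate {n = l} λ k → hd (drop (toℕ k) ys))
rebuild-tabulate zero    ys = refl
rebuild-tabulate (suc l) ys = cong (cons (hd ys)) (rebuild-tabulate l (tl ys))

module Racing {m} (F : Vec ℕ (suc m) → Vec ℕ (suc m)) (j : ℕ) (P : Fin (suc m) → Code (2 + m))
              (P-listed : ∀ k → hd (drop (toℕ k) j) ≡ ⌜ P k ⌝)
              (P-eval : ∀ k a → P k ⟦ j ∷ a ⟧↓ lookup (F a) k) where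

  outputsIn-sound : ∀ {a ys S} → T (valid S) → T (outputsIn (suc m) j (cons j (encodeVec a)) ys S) →
                    rebuild (suc m) ys ≡ encodeVec (F a)
  outputsIn-sound {a} {ys} {S} v outs = begin
    rebuild (suc m) ys                                ≡⟨ rebuild-tabulate (suc m) ys ⟩
    encodeVec (tabulate λ k → hd (drop (toℕ k) ys))   ≡⟨ cong encodeVec (tabulate-cong output) ⟩
    encodeVec (tabulate (lookup (F a)))               ≡⟨ cong encodeVec (tabulate∘lookup (F a)) ⟩
    encodeVec (F a)                                   ∎
    where
    open ≡-Reasoning
    output : ∀ k → hd (drop (toℕ k) ys) ≡ lookup (F a) k
    output k = ⟦⟧↓-deterministic
      (valid-sound v (subst (λ c → claim c _ _ ∈ᴺ S) (P-listed k)
                            (elemᴺ⁻ _ S (allBelow⁻ _ outs (toℕ k) (toℕ<n k)))))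
      (P-eval k a)

  outputs-certificate : ∀ a → ∃[ L ] Closed L ×
    (∀ z → z < suc m → claim (hd (drop z j)) (cons j (encodeVec a)) (hd (drop z (encodeVec (F a)))) ∈ L)
  outputs-certificate a = closed-⋃ (suc m) (λ L⊆L′ p → L⊆L′ p) λ z z<1+m →
    let k = fromℕ< z<1+m ; L , c , p = certificate (P-eval k a) in
    L , c , subst (λ z → claim (hd (drop z j)) (cons j (encodeVec a)) (hd (drop z (encodeVec (F a)))) ∈ L)
                  (toℕ-fromℕ< z<1+m)
                  (subst₂ (λ e y → claim e (cons j (encodeVec a)) y ∈ L) (sym (P-listed k))
                          (sym (hd-drop-encodeVec (F a) k)) p)

  stage-sound : ∀ (c₁ c₂ : Code (suc m)) a S → T (stage (suc m) ⌜ c₁ ⌝ ⌜ c₂ ⌝ j (encodeVec a) S) →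
                (∃[ y ] c₁ ⟦ a ⟧↓ y) ⊎ (∃[ y ] c₂ ⟦ F a ⟧↓ y)
  stage-sound c₁ c₂ a S st with to (T-∧ {valid S}) st
  ... | v , found with to (T-∨ {haltsIn ⌜ c₁ ⌝ (encodeVec a) S}) found
  ... | inj₁ halts₁ = inj₁ (haltsIn-sound c₁ a S v halts₁)
  ... | inj₂ via-F  =
    let ys , _ , q = anyBelow⁻ (suc S) _ via-F
        outs , halts₂ = to (T-∧ {outputsIn (suc m) j (cons j (encodeVec a)) ys S}) q
    in inj₂ (haltsIn-sound c₂ (F a) S v
              (subst (λ w → T (haltsIn ⌜ c₂ ⌝ w S)) (outputsIn-sound {a} {ys} {S} v outs) halts₂))

  racer-pack : ∀ c₁ c₂ s (a : Vec ℕ (suc m)) →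
               racer c₁ c₂ s (pack j a) ≡ anyBelow (suc s) (stage (suc m) c₁ c₂ j (encodeVec a))
  racer-pack c₁ c₂ s (a₀ ∷ rest) rewrite unpair₁-pair j a₀ | unpair₂-pair j a₀ = refl

  stage⇒racer : ∀ c₁ c₂ a S → T (stage (suc m) c₁ c₂ j (encodeVec a) S) → ∃[ s ] T (racer c₁ c₂ s (pack j a))
  stage⇒racer c₁ c₂ a S st = S , subst T (sym (racer-pack c₁ c₂ S a)) (anyBelow⁺ _ (n<1+n S) st)

  racer-sound : ∀ {R₁ R₂ : Rel (suc m)} (re₁ : RE R₁) (re₂ : RE R₂) a s →
                T (racer ⌜ proj₁ re₁ ⌝ ⌜ proj₁ re₂ ⌝ s (pack j a)) → R₁ a ⊎ R₂ (F a)
  racer-sound (c₁ , R₁⇔) (c₂ , R₂⇔) a s r =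
    let S , _ , st = anyBelow⁻ (suc s) _ (subst T (racer-pack ⌜ c₁ ⌝ ⌜ c₂ ⌝ s a) r) in
    Sum.map (from (R₁⇔ a)) (from (R₂⇔ (F a))) (stage-sound c₁ c₂ a S st)

  racer-complete₁ : ∀ {R₁ : Rel (suc m)} (re₁ : RE R₁) c₂ a → R₁ a →
                    ∃[ s ] T (racer ⌜ proj₁ re₁ ⌝ c₂ s (pack j a))
  racer-complete₁ (c₁ , R₁⇔) c₂ a r with to (R₁⇔ a) r
  ... | _ , c₁↓ with certificate c₁↓
  ... | L , c , p = stage⇒racer ⌜ c₁ ⌝ c₂ a (encodeList L)
    (from T-∧ (closed-valid L c , from T-∨ (inj₁ (haltsIn-encodeList p))))

  racer-complete₂ : ∀ c₁ {R₂ : Rel (suc m)} (re₂ : RE R₂) a → R₂ (F a) →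
                    ∃[ s ] T (racer c₁ ⌜ proj₁ re₂ ⌝ s (pack j a))
  racer-complete₂ c₁ (c₂ , R₂⇔) a r with to (R₂⇔ (F a)) r
  ... | y , c₂↓ with outputs-certificate a | certificate c₂↓
  ... | L₁ , c₁′ , p₁ | L₂ , c₂′ , p₂ = stage⇒racer c₁ ⌜ c₂ ⌝ a S
    (from T-∧ (closed-valid L (closed-++ c₁′ c₂′) , from (T-∨ {haltsIn c₁ (encodeVec a) S}) (inj₂ via-F)))
    where
    L : List ℕ
    L = L₁ ++ L₂
    S : ℕ
    S = encodeList L
    via-F : T (haltsOnOutputs (suc m) j ⌜ c₂ ⌝ (encodeVec a) S)
    via-F = anyBelow⁺ _ (<-encodeList _ (≤-claim₂ ⌜ c₂ ⌝ (encodeVec (F a)) y) (∈-++⁺ʳ L₁ p₂))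
      (from T-∧ ( allBelow⁺ (suc m) _ (λ z z<1+m → elemᴺ-encodeList (∈-++⁺ˡ (p₁ z z<1+m)))
                , subst (λ w → T (haltsIn ⌜ c₂ ⌝ w S)) (sym (rebuild-encodeVec (F a)))
                        (haltsIn-encodeList (∈-++⁺ʳ L₁ p₂))))

reduction-from-race : ∀ {m} {A B C D : Rel (suc m)} (reA : RE A) (reB : RE B) (reC : RE C) (reD : RE D) →
  Disjoint A B → Disjoint C D → ∀ G →
  IsSemiReduction G (Wins ⌜ proj₁ reC ⌝ ⌜ proj₁ reB ⌝ ⌜ proj₁ reD ⌝ ⌜ proj₁ reA ⌝)
                    (Wins ⌜ proj₁ reD ⌝ ⌜ proj₁ reA ⌝ ⌜ proj₁ reC ⌝ ⌜ proj₁ reB ⌝) A B →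
  ∃[ F ] IsReduction F C D A B
reduction-from-race {m} reA reB reC reD A#B C#D G (rG , semi) with selfReference G rG
... | j , P , P-listed , P-eval = F , recF-∘-pack G j rG , λ a →
  race-⇔ (h₁ a) (h₂ a) (racer-sound reC reB a) (racer-sound reD reA a)
         (racer-complete₁ reC ⌜ proj₁ reB ⌝ a) (racer-complete₂ ⌜ proj₁ reD ⌝ reA a)
         (proj₁ (semi (pack j a))) (proj₂ (semi (pack j a))) (C#D a) (A#B (F a)) ,
  race-⇔ (h₂ a) (h₁ a) (racer-sound reD reA a) (racer-sound reC reB a)
         (racer-complete₁ reD ⌜ proj₁ reA ⌝ a) (racer-complete₂ ⌜ proj₁ reC ⌝ reB a)
         (proj₂ (semi (pack j a))) (proj₁ (semi (pack j a))) (λ d c → C#D a c d) (λ b a′ → A#B (F a) a′ b)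
  where
  F : Vec ℕ (suc m) → Vec ℕ (suc m)
  F a = G (pack j a)
  open Racing F j P P-listed P-eval
  h₁ h₂ : Vec ℕ (suc m) → ℕ → Bool
  h₁ a s = racer ⌜ proj₁ reC ⌝ ⌜ proj₁ reB ⌝ s (pack j a)
  h₂ a s = racer ⌜ proj₁ reD ⌝ ⌜ proj₁ reA ⌝ s (pack j a)

theorem6p2 : (n : ℕ) → 1 ≤ n → (A B : Rel n) → RE A → RE B → Disjoint A B →
    SemiDU A B → DU A B
theorem6p2 (suc m) _ A B reA reB A#B semiDU C D reC reD C#D =
  let G , semi = semiDU (Wins cC cB cD cA) (Wins cD cA cC cB)
                        (RE-Wins cC cB cD cA) (RE-Wins cD cA cC cB) (Wins-disjoint cC cB cD cA)
  in reduction-from-race reA reB reC reD A#B C#D G semi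
  where
  cA cB cC cD : ℕ
  cA = ⌜ proj₁ reA ⌝
  cB = ⌜ proj₁ reB ⌝
  cC = ⌜ proj₁ reC ⌝
  cD = ⌜ proj₁ reD ⌝
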